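{- There exist two families $(P_{k})_{k \ge 1}$ and $(Q_{k})_{k \ge 1}$ of finite convexly independent subsets of $\mathbb{R}^{2}$ such that $|P_{k}| = |Q_{k}| = 2^{k}$ and $\mathrm{ci}(P_{k} + Q_{k}) \ge (k+2)2^{k-1}$ for all $k \ge 1$.
   Context: A finite set $C \subset \mathbb{R}^2$ is convexly independent if its points are the vertices of a convex polygon, i.e. $\mathrm{conv}(C)$ has exactly $|C|$ vertices. For a finite set $X \subset \mathbb{R}^2$, $\mathrm{ci}(X)$ denotes the largest size of a convexly independent subset of $X$. For sets $P, Q \subset \mathbb{R}^2$, $P+Q = \{p+q : p \in P, q \in Q\}$ is the Minkowski sum. -}

module Defs where

open import Data.Nat using (ℕ; _≤_)
open import Data.Fin using (Fin)
open import Data.Rational as ℚ using (ℚ; 0ℚ; 1ℚ)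
open import Data.Product using (_×_; _,_; ∃; ∃-syntax; Σ-syntax)
open import Data.List using (List; []; _∷_; length; foldr; zipWith; lookup; removeAt)
open import Data.List.Relation.Unary.All using (All)
open import Data.List.Relation.Unary.Unique.Propositional using (Unique)
open import Data.List.Membership.Propositional using (_∈_)
open import Relation.Binary.PropositionalEquality using (_≡_)
open import Relation.Nullary using (¬_)

Point : Set
Point = ℚ × ℚ

_+ᵖ_ : Point → Point → Point
(a , b) +ᵖ (c , d) = (a ℚ.+ c , b ℚ.+ d)

_·ᵖ_ : ℚ → Point → Point
t ·ᵖ (a , b) = (t ℚ.* a , t ℚ.* b)

0ᵖ : Point
0ᵖ = (0ℚ , 0ℚ)

FinSet : Set
FinSet = List Point

IsFinSet : FinSet → Set
IsFinSet X = Unique X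

sumℚ : List ℚ → ℚ
sumℚ = foldr ℚ._+_ 0ℚ

combo : List ℚ → List Point → Point
combo ws cs = foldr _+ᵖ_ 0ᵖ (zipWith _·ᵖ_ ws cs)

InConv : Point → List Point → Set
InConv p C = ∃[ ws ] (length ws ≡ length C × All (ℚ._≤_ 0ℚ) ws × sumℚ ws ≡ 1ℚ × combo ws C ≡ p)

IsVertex : (C : List Point) → Fin (length C) → Set
IsVertex C i = ¬ InConv (lookup C i) (removeAt C i)

-- C is convexly independent: conv(C) has exactly |C| vertices, i.e. every
-- point of C is a vertex of conv(C) (vertices of conv(C) always lie in C).
ConvIndep : List Point → Set
ConvIndep C = Unique C × (∀ i → IsVertex C i)

_∈Mink_ : Point → (List Point × List Point) → Set
x ∈Mink (P , Q) = ∃[ p ] ∃[ q ] (p ∈ P × q ∈ Q × x ≡ p +ᵖ q)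

ciMink≥ : List Point → List Point → ℕ → Set
ciMink≥ P Q m = ∃[ C ] (ConvIndep C × All (λ x → x ∈Mink (P , Q)) C × m ≤ length C)

{-# OPTIONS --safe #-}
-- Index points by bit strings b ∈ {0,1}^k, lowest digit first, and put a(b) = Σ bᵢ 8ⁱ and
-- s(b) = Σ bᵢ 64ⁱ; P_k and Q_k consist of p(b) = (a, 2a² + s) and q(b) = (a, 2a² − s).
-- If v arises from u by switching a single bit from 0 to 1, then s(v) − s(u) = (a(v) − a(u))²,
-- so p(u) + q(v) lies on the parabola y = x² at x = a(u) + a(v); trivially so does p(u) + q(u).
-- These pairs, the vertices and edges of the k-cube, number 2^k + k·2^(k−1), and their abscissae
-- a(u) + a(v) are distinct because adding two base-8 numbers with digits 0 and 1 produces no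
-- carries. Finally P_k and Q_k are convexly independent because the perturbation ± s is small,
-- |s(u) − s(v)| < 2(a(u) − a(v))², so the tangent of y = 2x² at any point of P_k or Q_k exposes
-- that point.
module Submission where

open import Defs
open import Data.Bool using (Bool; true; false)
open import Data.Empty using (⊥-elim)
open import Data.Fin using (zero; suc)
open import Data.List using (List; []; _∷_; _++_; map; length; lookup; removeAt; zipWith)
open import Data.List.Membership.Propositional using (_∈_)
open import Data.List.Membership.Propositional.Properties
  using (∈-map⁺; ∈-map⁻; ∈-++⁺ˡ; ∈-++⁺ʳ; ∈-++⁻; ∈-lookup)
open import Data.List.Properties using (length-map; length-++)
open import Data.List.Relation.Binary.Disjoint.Propositional using (Disjoint)
open import Data.List.Relation.Unary.All as All using (All; []; _∷_)
import Data.List.Relation.Unary.All.Properties as All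
open import Data.List.Relation.Unary.AllPairs using ([]; _∷_)
open import Data.List.Relation.Unary.Any using (here; there)
open import Data.List.Relation.Unary.Unique.Propositional using (Unique)
import Data.List.Relation.Unary.Unique.Propositional.Properties as Unique
open import Data.Nat using (ℕ; zero; suc)
import Data.Nat as ℕ
import Data.Nat.Properties as ℕ
open import Data.Product using (_×_; _,_; proj₁; proj₂; <_,_>; ∃-syntax; Σ-syntax)
open import Data.Rational using (ℚ)
open import Data.Sum using (inj₁; inj₂)
open import Data.Vec using (Vec; []; _∷_)
open import Data.Vec.Properties using (∷-injectiveʳ)
open import Function using (_∘_)
open import Relation.Binary.Definitions using (tri<; tri≈; tri>)
open import Relation.Binary.PropositionalEquality
  using (_≡_; _≢_; refl; sym; trans; cong; cong₂; subst; subst₂; module ≡-Reasoning)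
open import Relation.Nullary using (¬_)

module ConvexIndependence where
  open import Data.Rational
    using (0ℚ; 1ℚ; _+_; _*_; _-_; -_; ∣_∣; _≤_; _<_; positive; negative; nonNegative)
  import Data.Rational.Properties as ℚ
  open import Algebra.Properties.Group ℚ.+-0-group using (∙-cancelˡ)
  open import Data.Rational.Solver using (module +-*-Solver)
  open +-*-Solver using (solve; _:+_; _:*_; _:-_; :-_; _:=_; con)
  open ℚ.≤-Reasoning

  infix 8 _²
  _² : ℚ → ℚ
  p ² = p * p

  q-p+p≡q : ∀ p q → q - p + p ≡ q
  q-p+p≡q = solve 2 (λ p q → q :- p :+ p := q) refl

  p≤q⇒0≤q-p : ∀ {p q} → p ≤ q → 0ℚ ≤ q - p
  p≤q⇒0≤q-p {p} {q} p≤q = subst (_≤ q - p) (ℚ.+-inverseʳ p) (ℚ.+-monoˡ-≤ (- p) p≤q)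

  p<q⇒0<q-p : ∀ {p q} → p < q → 0ℚ < q - p
  p<q⇒0<q-p {p} {q} p<q = subst (_< q - p) (ℚ.+-inverseʳ p) (ℚ.+-monoˡ-< (- p) p<q)

  ≤-by-difference : ∀ {p q} d → q - p ≡ d → 0ℚ ≤ d → p ≤ q
  ≤-by-difference {p} {q} d q-p≡d 0≤d =
    subst₂ _≤_ (ℚ.+-identityˡ p) (q-p+p≡q p q) (ℚ.+-monoˡ-≤ p (subst (0ℚ ≤_) (sym q-p≡d) 0≤d))

  <-by-difference : ∀ {p q} d → q - p ≡ d → 0ℚ < d → p < q
  <-by-difference {p} {q} d q-p≡d 0<d =
    subst₂ _<_ (ℚ.+-identityˡ p) (q-p+p≡q p q) (ℚ.+-monoˡ-< p (subst (0ℚ <_) (sym q-p≡d) 0<d))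

  0≤∣p∣-p : ∀ p → 0ℚ ≤ ∣ p ∣ - p
  0≤∣p∣-p p with ℚ.∣p∣≡p∨∣p∣≡-p p
  ... | inj₁ ∣p∣≡p  = ℚ.≤-reflexive (trans (sym (ℚ.+-inverseʳ p)) (cong (_- p) (sym ∣p∣≡p)))
  ... | inj₂ ∣p∣≡-p = subst (λ q → 0ℚ ≤ ∣ p ∣ + q) ∣p∣≡-p (ℚ.+-mono-≤ (ℚ.0≤∣p∣ p) (ℚ.0≤∣p∣ p))

  0≤∣p∣+p : ∀ p → 0ℚ ≤ ∣ p ∣ + p
  0≤∣p∣+p p with ℚ.∣p∣≡p∨∣p∣≡-p p
  ... | inj₁ ∣p∣≡p  = subst (λ q → 0ℚ ≤ ∣ p ∣ + q) ∣p∣≡p (ℚ.+-mono-≤ (ℚ.0≤∣p∣ p) (ℚ.0≤∣p∣ p))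
  ... | inj₂ ∣p∣≡-p = ℚ.≤-reflexive (trans (sym (ℚ.+-inverseˡ p)) (cong (_+ p) (sym ∣p∣≡-p)))

  p≤∣p∣ : ∀ p → p ≤ ∣ p ∣
  p≤∣p∣ p = ≤-by-difference _ refl (0≤∣p∣-p p)

  0<p² : ∀ {p} → p ≢ 0ℚ → 0ℚ < p ²
  0<p² {p} p≢0 with ℚ.<-cmp p 0ℚ
  ... | tri< p<0 _ _ = ℚ.positive⁻¹ _ {{ℚ.neg*neg⇒pos p {{negative p<0}} p {{negative p<0}}}}
  ... | tri≈ _ p≡0 _ = ⊥-elim (p≢0 p≡0)
  ... | tri> _ _ 0<p = ℚ.positive⁻¹ _ {{ℚ.pos*pos⇒pos p {{positive 0<p}} p {{positive 0<p}}}}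

  infix 8 _·_
  _·_ : Point → Point → ℚ
  (α , β) · (x , y) = α * x + β * y

  ·-zeroʳ : ∀ n → n · 0ᵖ ≡ 0ℚ
  ·-zeroʳ (α , β) = cong₂ _+_ (ℚ.*-zeroʳ α) (ℚ.*-zeroʳ β)

  ·-linear : ∀ n w y z → n · ((w ·ᵖ y) +ᵖ z) ≡ w * n · y + n · z
  ·-linear (α , β) w (y₁ , y₂) (z₁ , z₂) = solve 7
    (λ α β w y₁ y₂ z₁ z₂ → α :* (w :* y₁ :+ z₁) :+ β :* (w :* y₂ :+ z₂)
                        := w :* (α :* y₁ :+ β :* y₂) :+ (α :* z₁ :+ β :* z₂))
    refl α β w y₁ y₂ z₁ z₂

  weighted : List ℚ → List ℚ → ℚ
  weighted ws vs = sumℚ (zipWith _*_ ws vs)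

  ·-combo : ∀ n ws ys → n · combo ws ys ≡ weighted ws (map (n ·_) ys)
  ·-combo n []       _        = ·-zeroʳ n
  ·-combo n (_ ∷ _)  []       = ·-zeroʳ n
  ·-combo n (w ∷ ws) (y ∷ ys) =
    trans (·-linear n w y (combo ws ys)) (cong (w * n · y +_) (·-combo n ws ys))

  w*c+c*σ≡c*[w+σ] : ∀ c w σ → w * c + c * σ ≡ c * (w + σ)
  w*c+c*σ≡c*[w+σ] = solve 3 (λ c w σ → w :* c :+ c :* σ := c :* (w :+ σ)) refl

  weighted-≤ : ∀ {c ws vs} → length ws ≡ length vs → All (0ℚ ≤_) ws → All (_≤ c) vs →
               weighted ws vs ≤ c * sumℚ ws
  weighted-≤ {c} _ [] [] = ℚ.≤-reflexive (sym (ℚ.*-zeroʳ c))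
  weighted-≤ {c} {w ∷ ws} {v ∷ vs} len (0≤w ∷ 0≤ws) (v≤c ∷ vs≤c) = begin
    w * v + weighted ws vs ≤⟨ ℚ.+-mono-≤ (ℚ.*-monoˡ-≤-nonNeg w {{nonNegative 0≤w}} v≤c)
                                          (weighted-≤ (ℕ.suc-injective len) 0≤ws vs≤c) ⟩
    w * c + c * sumℚ ws    ≡⟨ w*c+c*σ≡c*[w+σ] c w (sumℚ ws) ⟩
    c * (w + sumℚ ws)      ∎

  weighted-< : ∀ {c ws vs} → length ws ≡ length vs → All (0ℚ ≤_) ws → All (_< c) vs →
               0ℚ < sumℚ ws → weighted ws vs < c * sumℚ ws
  weighted-< _ [] [] 0<0 = ⊥-elim (ℚ.<-irrefl refl 0<0)
  weighted-< {c} {w ∷ ws} {v ∷ vs} len (0≤w ∷ 0≤ws) (v<c ∷ vs<c) 0<Σ with ℚ.<-cmp 0ℚ w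
  ... | tri< 0<w _ _ = begin-strict
    w * v + weighted ws vs <⟨ ℚ.+-mono-<-≤ (ℚ.*-monoʳ-<-pos w {{positive 0<w}} v<c)
                                (weighted-≤ (ℕ.suc-injective len) 0≤ws (All.map ℚ.<⇒≤ vs<c)) ⟩
    w * c + c * sumℚ ws    ≡⟨ w*c+c*σ≡c*[w+σ] c w (sumℚ ws) ⟩
    c * (w + sumℚ ws)      ∎
  ... | tri≈ _ refl _ = begin-strict
    0ℚ * v + weighted ws vs ≡⟨ cong (_+ weighted ws vs) (ℚ.*-zeroˡ v) ⟩
    0ℚ + weighted ws vs     ≡⟨ ℚ.+-identityˡ _ ⟩
    weighted ws vs          <⟨ weighted-< (ℕ.suc-injective len) 0≤ws vs<c
                                 (subst (0ℚ <_) (ℚ.+-identityˡ _) 0<Σ) ⟩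
    c * sumℚ ws             ≡⟨ cong (c *_) (ℚ.+-identityˡ _) ⟨
    c * (0ℚ + sumℚ ws)      ∎
  ... | tri> _ _ w<0 = ⊥-elim (ℚ.<-irrefl refl (ℚ.≤-<-trans 0≤w w<0))

  separated⇒∉conv : ∀ {n x ys} → All (λ y → n · y < n · x) ys → ¬ InConv x ys
  separated⇒∉conv {n} {x} {ys} ys<x (ws , len , 0≤ws , Σws≡1 , combo≡x) =
    ℚ.<-irrefl refl (begin-strict
      n · x                       ≡⟨ cong (n ·_) combo≡x ⟨
      n · combo ws ys             ≡⟨ ·-combo n ws ys ⟩
      weighted ws (map (n ·_) ys) <⟨ weighted-< (trans len (sym (length-map (n ·_) ys))) 0≤ws
                                       (All.map⁺ ys<x) (subst (0ℚ <_) (sym Σws≡1) (ℚ.positive⁻¹ 1ℚ)) ⟩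
      n · x * sumℚ ws             ≡⟨ cong (n · x *_) Σws≡1 ⟩
      n · x * 1ℚ                  ≡⟨ ℚ.*-identityʳ (n · x) ⟩
      n · x                       ∎)

  ∈-removeAt⁻ : ∀ {A : Set} {xs : List A} {y} → Unique xs → ∀ i →
                y ∈ removeAt xs i → y ∈ xs × y ≢ lookup xs i
  ∈-removeAt⁻ (x∉xs ∷ _)      zero    y∈xs        = there y∈xs , λ y≡x → All.lookup x∉xs y∈xs (sym y≡x)
  ∈-removeAt⁻ (x∉xs ∷ _)      (suc i) (here refl) = here refl , All.lookup x∉xs (∈-lookup i)
  ∈-removeAt⁻ (_ ∷ xs-unique) (suc i) (there y∈)  with ∈-removeAt⁻ xs-unique i y∈
  ... | y∈xs , y≢ = there y∈xs , y≢

  ExposedIn : List Point → Point → Set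
  ExposedIn C x = ∃[ n ] (∀ {y} → y ∈ C → y ≢ x → n · y < n · x)

  exposed⇒convIndep : ∀ {C} → Unique C → (∀ {x} → x ∈ C → ExposedIn C x) → ConvIndep C
  exposed⇒convIndep {C} C-unique exposed = C-unique , vertex
    where
    vertex : ∀ i → IsVertex C i
    vertex i with exposed (∈-lookup {xs = C} i)
    ... | n , separates = separated⇒∉conv {n} (All.tabulate λ y∈ →
          let y∈C , y≢x = ∈-removeAt⁻ C-unique i y∈ in separates y∈C y≢x)

  parabola : ℚ → ℚ × ℚ → Point
  parabola c (x , σ) = x , c * x ² + σ

  parabola-injective : ∀ c {u v} → parabola c u ≡ parabola c v → u ≡ v
  parabola-injective c {x , σ} {x′ , σ′} eq with cong proj₁ eq
  ... | refl = cong (x ,_) (∙-cancelˡ (c * x ²) σ σ′ (cong proj₂ eq))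

  parabola-gap : ∀ c x σ x′ σ′ →
    (c * (x + x) , - 1ℚ) · parabola c (x , σ) - (c * (x + x) , - 1ℚ) · parabola c (x′ , σ′)
      ≡ c * (x - x′) ² - (σ - σ′)
  parabola-gap = solve 5 (λ c x σ x′ σ′ →
      (c :* (x :+ x) :* x :+ (:- con 1ℚ) :* (c :* (x :* x) :+ σ))
        :- (c :* (x :+ x) :* x′ :+ (:- con 1ℚ) :* (c :* (x′ :* x′) :+ σ′))
      := c :* ((x :- x′) :* (x :- x′)) :- (σ :- σ′)) refl

  parabola-convIndep : ∀ c {cs} → Unique cs →
    (∀ {u v} → u ∈ cs → v ∈ cs → u ≢ v →
       ∣ proj₂ u - proj₂ v ∣ < c * (proj₁ u - proj₁ v) ²) →
    ConvIndep (map (parabola c) cs)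
  parabola-convIndep c {cs} cs-unique small =
    exposed⇒convIndep (Unique.map⁺ (parabola-injective c) cs-unique) exposed
    where
    exposed : ∀ {p} → p ∈ map (parabola c) cs → ExposedIn (map (parabola c) cs) p
    exposed p∈ with ∈-map⁻ (parabola c) p∈
    ... | u@(x , σ) , u∈ , refl = normal , separates
      where
      normal = c * (x + x) , - 1ℚ
      separates : ∀ {q} → q ∈ map (parabola c) cs → q ≢ parabola c u →
                  normal · q < normal · parabola c u
      separates q∈ q≢p with ∈-map⁻ (parabola c) q∈
      ... | v@(x′ , σ′) , v∈ , refl = <-by-difference _ (parabola-gap c x σ x′ σ′)
            (p<q⇒0<q-p (ℚ.≤-<-trans (p≤∣p∣ (σ - σ′)) (small u∈ v∈ (q≢p ∘ cong (parabola c) ∘ sym))))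

open ConvexIndependence

module Cube where
  open import Data.Nat using (_+_; _*_; _^_; _<_; _≤_; NonZero; >-nonZero; z<s; s<s; s≤s; z≤n)
  open import Data.Nat.DivMod using (_%_; [m+kn]%n≡m%n; m<n⇒m%n≡m)
  open import Data.Nat.Solver using (module +-*-Solver)
  open +-*-Solver using (solve; _:+_; _:*_; _:=_; con)
  open ≡-Reasoning

  bit : Bool → ℕ
  bit false = 0
  bit true  = 1

  bit<2 : ∀ t → bit t < 2
  bit<2 false = z<s
  bit<2 true  = s<s z<s

  bit-injective : ∀ {t t′} → bit t ≡ bit t′ → t ≡ t′
  bit-injective {false} {false} _ = refl
  bit-injective {true}  {true}  _ = refl

  value : ∀ {k} → ℕ → Vec Bool k → ℕ
  value β []      = 0
  value β (t ∷ b) = bit t + value β b * β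

  digit-injective : ∀ {β} .{{_ : NonZero β}} {c c′ m n} → c < β → c′ < β →
                    c + m * β ≡ c′ + n * β → c ≡ c′ × m ≡ n
  digit-injective {β} {c} {c′} {m} {n} c<β c′<β eq =
    c≡c′ , ℕ.*-cancelʳ-≡ m n β (ℕ.+-cancelˡ-≡ c _ _ (trans eq (cong (_+ n * β) (sym c≡c′))))
    where
    c≡c′ : c ≡ c′
    c≡c′ = begin
      c                ≡⟨ m<n⇒m%n≡m c<β ⟨
      c % β            ≡⟨ [m+kn]%n≡m%n c m β ⟨
      (c + m * β) % β  ≡⟨ cong (_% β) eq ⟩
      (c′ + n * β) % β ≡⟨ [m+kn]%n≡m%n c′ n β ⟩
      c′ % β           ≡⟨ m<n⇒m%n≡m c′<β ⟩
      c′               ∎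

  value-injective : ∀ {β k} {u v : Vec Bool k} → 2 ≤ β → value β u ≡ value β v → u ≡ v
  value-injective {u = []}    {[]}     _   _  = refl
  value-injective {u = t ∷ u} {t′ ∷ v} 2≤β eq
    with digit-injective {{>-nonZero (ℕ.<-≤-trans z<s 2≤β)}}
           (ℕ.<-≤-trans (bit<2 t) 2≤β) (ℕ.<-≤-trans (bit<2 t′) 2≤β) eq
  ... | t≡t′ , u≡v = cong₂ _∷_ (bit-injective t≡t′) (value-injective 2≤β u≡v)

  -- Faces of dimension at most 1 of the cube {0,1}^k, lowest coordinate first: in `free b` the
  -- lowest coordinate is the free one of an edge and b fixes all higher coordinates.
  data Cell : ℕ → Set where
    point : Cell zero
    fix   : ∀ {k} → Bool → Cell k → Cell (suc k)
    free  : ∀ {k} → Vec Bool k → Cell (suc k)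

  fix-injective : ∀ {k t} {c c′ : Cell k} → fix t c ≡ fix t c′ → c ≡ c′
  fix-injective refl = refl

  free-injective : ∀ {k} {b b′ : Vec Bool k} → free b ≡ free b′ → b ≡ b′
  free-injective refl = refl

  bottom top : ∀ {k} → Cell k → Vec Bool k
  bottom point     = []
  bottom (fix t c) = t ∷ bottom c
  bottom (free b)  = false ∷ b
  top point        = []
  top (fix t c)    = t ∷ top c
  top (free b)     = true ∷ b

  abscissa : ∀ {k} → Cell k → ℕ
  abscissa c = value 8 (bottom c) + value 8 (top c)

  lowDigit highPart : ∀ {k} → Cell (suc k) → ℕ
  lowDigit (fix t _) = bit t + bit t
  lowDigit (free _)  = 1
  highPart (fix _ c) = abscissa c
  highPart (free b)  = 2 * value 8 b

  lowDigit<8 : ∀ {k} (c : Cell (suc k)) → lowDigit c < 8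
  lowDigit<8 (fix false _) = z<s
  lowDigit<8 (fix true _)  = s<s (s<s z<s)
  lowDigit<8 (free _)      = s<s z<s

  abscissa-digits : ∀ {k} (c : Cell (suc k)) → abscissa c ≡ lowDigit c + highPart c * 8
  abscissa-digits (fix t c) = solve 3 (λ t m n → (t :+ m :* con 8) :+ (t :+ n :* con 8)
                                              := (t :+ t) :+ (m :+ n) :* con 8)
                                refl (bit t) (value 8 (bottom c)) (value 8 (top c))
  abscissa-digits (free b)  = solve 1 (λ m → (m :* con 8) :+ (con 1 :+ m :* con 8)
                                            := con 1 :+ (con 2 :* m) :* con 8)
                                refl (value 8 b)

  abscissa-injective : ∀ {k} {c c′ : Cell k} → abscissa c ≡ abscissa c′ → c ≡ c′
  abscissa-injective {c = point} {point} _ = refl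
  abscissa-injective {k = suc _} {c} {c′} eq
    with digit-injective {m = highPart c} {highPart c′} (lowDigit<8 c) (lowDigit<8 c′)
           (trans (sym (abscissa-digits c)) (trans eq (abscissa-digits c′)))
  abscissa-injective {c = fix false c} {fix false c′} _ | _ , eq = cong (fix false) (abscissa-injective eq)
  abscissa-injective {c = fix true c}  {fix true c′}  _ | _ , eq = cong (fix true) (abscissa-injective eq)
  abscissa-injective {c = free b}      {free b′}      _ | _ , eq =
    cong free (value-injective {8} (s≤s (s≤s z≤n)) (ℕ.*-cancelˡ-≡ _ _ 2 eq))
  abscissa-injective {c = fix false _} {fix true _}  _ | () , _
  abscissa-injective {c = fix true _}  {fix false _} _ | () , _
  abscissa-injective {c = fix false _} {free _}      _ | () , _
  abscissa-injective {c = fix true _}  {free _}      _ | () , _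
  abscissa-injective {c = free _}      {fix false _} _ | () , _
  abscissa-injective {c = free _}      {fix true _}  _ | () , _

  bitVecs : ∀ k → List (Vec Bool k)
  bitVecs zero    = [] ∷ []
  bitVecs (suc k) = map (false ∷_) (bitVecs k) ++ map (true ∷_) (bitVecs k)

  cells : ∀ k → List (Cell k)
  cells zero    = point ∷ []
  cells (suc k) = map (fix false) (cells k) ++ map (fix true) (cells k) ++ map free (bitVecs k)

  ∈-bitVecs : ∀ {k} (b : Vec Bool k) → b ∈ bitVecs k
  ∈-bitVecs []               = here refl
  ∈-bitVecs (false ∷ b)      = ∈-++⁺ˡ (∈-map⁺ (false ∷_) (∈-bitVecs b))
  ∈-bitVecs {suc k} (true ∷ b) = ∈-++⁺ʳ (map (false ∷_) (bitVecs k)) (∈-map⁺ (true ∷_) (∈-bitVecs b))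

  map-disjoint : ∀ {A B C : Set} {f : A → C} {g : B → C} {xs ys} →
                 (∀ {x y} → f x ≢ g y) → Disjoint (map f xs) (map g ys)
  map-disjoint {f = f} {g} f≢g (v∈fxs , v∈gys) with ∈-map⁻ f v∈fxs | ∈-map⁻ g v∈gys
  ... | _ , _ , refl | _ , _ , fx≡gy = f≢g fx≡gy

  bitVecs-unique : ∀ k → Unique (bitVecs k)
  bitVecs-unique zero    = [] ∷ []
  bitVecs-unique (suc k) =
    Unique.++⁺ (Unique.map⁺ ∷-injectiveʳ (bitVecs-unique k)) (Unique.map⁺ ∷-injectiveʳ (bitVecs-unique k))
               (map-disjoint λ ())

  cells-unique : ∀ k → Unique (cells k)
  cells-unique zero    = [] ∷ []
  cells-unique (suc k) =
    Unique.++⁺ (Unique.map⁺ fix-injective (cells-unique k))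
      (Unique.++⁺ (Unique.map⁺ fix-injective (cells-unique k)) (Unique.map⁺ free-injective (bitVecs-unique k))
                  (map-disjoint λ ()))
      fix-false-disjoint
    where
    fix-false-disjoint : Disjoint (map (fix false) (cells k)) (map (fix true) (cells k) ++ map free (bitVecs k))
    fix-false-disjoint (v∈₀ , v∈) with ∈-++⁻ (map (fix true) (cells k)) v∈
    ... | inj₁ v∈₁ = map-disjoint (λ ()) (v∈₀ , v∈₁)
    ... | inj₂ v∈₂ = map-disjoint (λ ()) (v∈₀ , v∈₂)

  length-map-++ : ∀ {A B C : Set} (f : A → C) (g : B → C) xs ys →
                  length (map f xs ++ map g ys) ≡ length xs + length ys
  length-map-++ f g xs ys = trans (length-++ (map f xs)) (cong₂ _+_ (length-map f xs) (length-map g ys))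

  length-map∘map : ∀ {A B C : Set} (f : B → C) (g : A → B) xs → length (map f (map g xs)) ≡ length xs
  length-map∘map f g xs = trans (length-map f (map g xs)) (length-map g xs)

  length-bitVecs : ∀ k → length (bitVecs k) ≡ 2 ^ k
  length-bitVecs zero    = refl
  length-bitVecs (suc k) = begin
    length (bitVecs (suc k))                ≡⟨ length-map-++ (false ∷_) (true ∷_) (bitVecs k) (bitVecs k) ⟩
    length (bitVecs k) + length (bitVecs k) ≡⟨ cong (λ n → n + n) (length-bitVecs k) ⟩
    2 ^ k + 2 ^ k                           ≡⟨ cong (2 ^ k +_) (ℕ.+-identityʳ (2 ^ k)) ⟨
    2 ^ suc k                               ∎

  length-cells-step : ∀ k → length (cells (suc k)) ≡ length (cells k) + (length (cells k) + length (bitVecs k))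
  length-cells-step k = trans (length-++ (map (fix false) (cells k)))
    (cong₂ _+_ (length-map (fix false) (cells k)) (length-map-++ (fix true) free (cells k) (bitVecs k)))

  length-cells : ∀ k → length (cells (suc k)) ≡ (suc k + 2) * 2 ^ k
  length-cells zero    = refl
  length-cells (suc k) = begin
    length (cells (suc (suc k)))
      ≡⟨ length-cells-step (suc k) ⟩
    length (cells (suc k)) + (length (cells (suc k)) + length (bitVecs (suc k)))
      ≡⟨ cong₂ (λ l n → l + (l + n)) (length-cells k) (length-bitVecs (suc k)) ⟩
    (suc k + 2) * 2 ^ k + ((suc k + 2) * 2 ^ k + 2 * 2 ^ k)
      ≡⟨ solve 2 (λ k n → (con 1 :+ k :+ con 2) :* n :+ ((con 1 :+ k :+ con 2) :* n :+ con 2 :* n)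
                        := (con 2 :+ k :+ con 2) :* (con 2 :* n)) refl k (2 ^ k) ⟩
    (suc (suc k) + 2) * 2 ^ suc k
      ∎

open Cube

module Construction where
  open import Data.Rational using (0ℚ; 1ℚ; ½; _+_; _*_; _-_; -_; ∣_∣; _≤_; _<_; nonNegative)
  import Data.Rational.Properties as ℚ
  open import Algebra.Bundles using (Ring)
  import Algebra.Properties.Semiring.Mult (Ring.semiring ℚ.+-*-ring) as Mult
  open import Algebra.Properties.Group ℚ.+-0-group using (x∙y⁻¹≈ε⇒x≈y)
  open import Data.Rational.Solver using (module +-*-Solver)
  open +-*-Solver using (solve; _:+_; _:*_; _:-_; :-_; _:=_; con)
  open ℚ.≤-Reasoning

  fromℕ : ℕ → ℚ
  fromℕ n = n Mult.× 1ℚ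

  fromℕ-+ : ∀ m n → fromℕ (m ℕ.+ n) ≡ fromℕ m + fromℕ n
  fromℕ-+ = Mult.×-homo-+ 1ℚ

  fromℕ-* : ∀ m n → fromℕ (m ℕ.* n) ≡ fromℕ m * fromℕ n
  fromℕ-* = Mult.×1-homo-*

  0≤fromℕ : ∀ n → 0ℚ ≤ fromℕ n
  0≤fromℕ zero    = ℚ.≤-refl
  0≤fromℕ (suc n) = ℚ.+-mono-≤ (ℚ.nonNegative⁻¹ 1ℚ) (0≤fromℕ n)

  0≤fromℕ* : ∀ n {p} → 0ℚ ≤ p → 0ℚ ≤ fromℕ n * p
  0≤fromℕ* n {p} 0≤p = ℚ.nonNegative⁻¹ _
    {{ℚ.nonNeg*nonNeg⇒nonNeg (fromℕ n) {{nonNegative (0≤fromℕ n)}} p {{nonNegative 0≤p}}}}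

  fromℕ-mono-≤ : ∀ {m n} → m ℕ.≤ n → fromℕ m ≤ fromℕ n
  fromℕ-mono-≤ {n = n} ℕ.z≤n = 0≤fromℕ n
  fromℕ-mono-≤ (ℕ.s≤s m≤n)   = ℚ.+-monoʳ-≤ 1ℚ (fromℕ-mono-≤ m≤n)

  fromℕ-mono-< : ∀ {m n} → m ℕ.< n → fromℕ m < fromℕ n
  fromℕ-mono-< {m} m<n = ℚ.<-≤-trans m<1+m (fromℕ-mono-≤ m<n)
    where
    m<1+m : fromℕ m < fromℕ (suc m)
    m<1+m = <-by-difference 1ℚ (solve 1 (λ x → con 1ℚ :+ x :- x := con 1ℚ) refl (fromℕ m))
                            (ℚ.positive⁻¹ 1ℚ)

  fromℕ-injective : ∀ {m n} → fromℕ m ≡ fromℕ n → m ≡ n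
  fromℕ-injective {m} {n} eq with ℕ.<-cmp m n
  ... | tri< m<n _ _ = ⊥-elim (ℚ.<⇒≢ (fromℕ-mono-< m<n) eq)
  ... | tri≈ _ m≡n _ = m≡n
  ... | tri> _ _ n<m = ⊥-elim (ℚ.<⇒≢ (fromℕ-mono-< n<m) (sym eq))

  a s : ∀ {k} → Vec Bool k → ℚ
  a b = fromℕ (value 8 b)
  s b = fromℕ (value 64 b)

  fromℕ-value : ∀ {k} β t (b : Vec Bool k) →
                fromℕ (value β (t ∷ b)) ≡ fromℕ (bit t) + fromℕ (value β b) * fromℕ β
  fromℕ-value β t b = trans (fromℕ-+ (bit t) _) (cong (fromℕ (bit t) +_) (fromℕ-* (value β b) β))

  a-injective : ∀ {k} {u v : Vec Bool k} → a u ≡ a v → u ≡ v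
  a-injective = value-injective (ℕ.s≤s (ℕ.s≤s ℕ.z≤n)) ∘ fromℕ-injective

  fixed-digit-square : ∀ e σ x y β →
    e + (σ + (x - y) ²) * (β * β) ≡ e + σ * (β * β) + (e + x * β - (e + y * β)) ²
  fixed-digit-square = solve 5 (λ e σ x y β →
      e :+ (σ :+ (x :- y) :* (x :- y)) :* (β :* β)
        := e :+ σ :* (β :* β) :+ (e :+ x :* β :- (e :+ y :* β)) :* (e :+ x :* β :- (e :+ y :* β)))
    refl

  free-digit-square : ∀ σ x β → 1ℚ + σ * (β * β) ≡ 0ℚ + σ * (β * β) + (0ℚ + x * β - (1ℚ + x * β)) ²
  free-digit-square = solve 3 (λ σ x β →
      con 1ℚ :+ σ :* (β :* β)
        := con 0ℚ :+ σ :* (β :* β) :+ (con 0ℚ :+ x :* β :- (con 1ℚ :+ x :* β))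
                                   :* (con 0ℚ :+ x :* β :- (con 1ℚ :+ x :* β)))
    refl

  s-top : ∀ {k} (c : Cell k) → s (top c) ≡ s (bottom c) + (a (bottom c) - a (top c)) ²
  s-top point     = refl
  s-top (fix t c) = begin-equality
      s (t ∷ top c)
    ≡⟨ fromℕ-value 64 t (top c) ⟩
      e + s (top c) * fromℕ 64
    ≡⟨ cong (λ σ → e + σ * fromℕ 64) (s-top c) ⟩
      e + (s (bottom c) + (x - y) ²) * fromℕ 64
    ≡⟨ fixed-digit-square e (s (bottom c)) x y (fromℕ 8) ⟩
      e + s (bottom c) * fromℕ 64 + (e + x * fromℕ 8 - (e + y * fromℕ 8)) ²
    ≡⟨ cong₂ (λ σ d → σ + d ²) (fromℕ-value 64 t (bottom c))
             (cong₂ _-_ (fromℕ-value 8 t (bottom c)) (fromℕ-value 8 t (top c))) ⟨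
      s (t ∷ bottom c) + (a (t ∷ bottom c) - a (t ∷ top c)) ²
    ∎
    where
    e = fromℕ (bit t)
    x = a (bottom c)
    y = a (top c)
  s-top (free b)  = begin-equality
      s (true ∷ b)
    ≡⟨ fromℕ-value 64 true b ⟩
      1ℚ + s b * fromℕ 64
    ≡⟨ free-digit-square (s b) (a b) (fromℕ 8) ⟩
      0ℚ + s b * fromℕ 64 + (0ℚ + a b * fromℕ 8 - (1ℚ + a b * fromℕ 8)) ²
    ≡⟨ cong₂ (λ σ d → σ + d ²) (fromℕ-value 64 false b)
             (cong₂ _-_ (fromℕ-value 8 false b) (fromℕ-value 8 true b)) ⟨
      s (false ∷ b) + (a (false ∷ b) - a (true ∷ b)) ²
    ∎

  -- Satisfied by (a u − a v , s u − s v) and preserved by appending a digit to u and v; the slack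
  -- |x| is what absorbs the cross term 48·x·e of the new square.
  DigitBound : ℚ → ℚ → Set
  DigitBound x y = fromℕ 2 * ∣ y ∣ + ∣ x ∣ ≤ fromℕ 3 * x ²

  ∣p+q*n∣≤∣p∣+∣q∣*n : ∀ p q n → ∣ p + q * fromℕ n ∣ ≤ ∣ p ∣ + ∣ q ∣ * fromℕ n
  ∣p+q*n∣≤∣p∣+∣q∣*n p q n = begin
    ∣ p + q * fromℕ n ∣               ≤⟨ ℚ.∣p+q∣≤∣p∣+∣q∣ p (q * fromℕ n) ⟩
    ∣ p ∣ + ∣ q * fromℕ n ∣           ≡⟨ cong (∣ p ∣ +_) (ℚ.∣p*q∣≡∣p∣*∣q∣ q (fromℕ n)) ⟩
    ∣ p ∣ + ∣ q ∣ * ∣ fromℕ n ∣       ≡⟨ cong (λ m → ∣ p ∣ + ∣ q ∣ * m) (ℚ.0≤p⇒∣p∣≡p (0≤fromℕ n)) ⟩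
    ∣ p ∣ + ∣ q ∣ * fromℕ n           ∎

  digitBound-step : ∀ {x y} e → ∣ e ∣ ≤ 1ℚ → e ² ≡ ∣ e ∣ → DigitBound x y →
                    DigitBound (e + x * fromℕ 8) (e + y * fromℕ 64)
  digitBound-step {x} {y} e ∣e∣≤1 e²≡∣e∣ bound = ≤-by-difference (slack ∣ e ∣) gap 0≤slack
    where
    X = ∣ e + x * fromℕ 8 ∣
    Y = ∣ e + y * fromℕ 64 ∣
    slack : ℚ → ℚ
    slack ε = fromℕ 2 * (ε + ∣ y ∣ * fromℕ 64 - Y) + (ε + ∣ x ∣ * fromℕ 8 - X)
        + fromℕ 64 * (fromℕ 3 * x ² - (fromℕ 2 * ∣ y ∣ + ∣ x ∣))
        + fromℕ 48 * (∣ x * e ∣ + x * e + (∣ x ∣ - ∣ x * e ∣)) + fromℕ 8 * ∣ x ∣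
    gap : fromℕ 3 * (e + x * fromℕ 8) ² - (fromℕ 2 * Y + X) ≡ slack ∣ e ∣
    gap = trans (solve 7 (λ e x ξ υ X Y w →
        con (fromℕ 3) :* ((e :+ x :* con (fromℕ 8)) :* (e :+ x :* con (fromℕ 8)))
          :- (con (fromℕ 2) :* Y :+ X)
        := con (fromℕ 2) :* (e :* e :+ υ :* con (fromℕ 64) :- Y) :+ (e :* e :+ ξ :* con (fromℕ 8) :- X)
           :+ con (fromℕ 64) :* (con (fromℕ 3) :* (x :* x) :- (con (fromℕ 2) :* υ :+ ξ))
           :+ con (fromℕ 48) :* (w :+ x :* e :+ (ξ :- w)) :+ con (fromℕ 8) :* ξ)
        refl e x (∣ x ∣) (∣ y ∣) X Y (∣ x * e ∣)) (cong slack e²≡∣e∣)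
    ∣xe∣≤∣x∣ : ∣ x * e ∣ ≤ ∣ x ∣
    ∣xe∣≤∣x∣ = begin
      ∣ x * e ∣     ≡⟨ ℚ.∣p*q∣≡∣p∣*∣q∣ x e ⟩
      ∣ x ∣ * ∣ e ∣ ≤⟨ ℚ.*-monoˡ-≤-nonNeg ∣ x ∣ {{ℚ.∣-∣-nonNeg x}} ∣e∣≤1 ⟩
      ∣ x ∣ * 1ℚ    ≡⟨ ℚ.*-identityʳ ∣ x ∣ ⟩
      ∣ x ∣         ∎
    0≤slack : 0ℚ ≤ slack ∣ e ∣
    0≤slack = ℚ.+-mono-≤ (ℚ.+-mono-≤ (ℚ.+-mono-≤ (ℚ.+-mono-≤
            (0≤fromℕ* 2 (p≤q⇒0≤q-p (∣p+q*n∣≤∣p∣+∣q∣*n e y 64)))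
            (p≤q⇒0≤q-p (∣p+q*n∣≤∣p∣+∣q∣*n e x 8)))
            (0≤fromℕ* 64 (p≤q⇒0≤q-p bound)))
            (0≤fromℕ* 48 (ℚ.+-mono-≤ (0≤∣p∣+p (x * e)) (p≤q⇒0≤q-p ∣xe∣≤∣x∣))))
            (0≤fromℕ* 8 (ℚ.0≤∣p∣ x))

  digitBound⇒small : ∀ {x y} → DigitBound x y → x ≢ 0ℚ → ∣ y ∣ < fromℕ 2 * x ²
  digitBound⇒small {x} {y} bound x≢0 = <-by-difference (½ * slack) gap (ℚ.*-monoʳ-<-pos ½ 0<slack)
    where
    slack = fromℕ 3 * x ² - (fromℕ 2 * ∣ y ∣ + ∣ x ∣) + x ² + ∣ x ∣
    gap : fromℕ 2 * x ² - ∣ y ∣ ≡ ½ * slack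
    gap = solve 3 (λ x ξ υ → con (fromℕ 2) :* (x :* x) :- υ
                  := con ½ :* (con (fromℕ 3) :* (x :* x) :- (con (fromℕ 2) :* υ :+ ξ) :+ x :* x :+ ξ))
                refl x (∣ x ∣) (∣ y ∣)
    0<slack : 0ℚ < slack
    0<slack = ℚ.+-mono-<-≤ (ℚ.+-mono-≤-< (p≤q⇒0≤q-p bound) (0<p² x≢0)) (ℚ.0≤∣p∣ x)

  difference-∷ : ∀ {k} β t t′ (u v : Vec Bool k) →
    fromℕ (value β (t ∷ u)) - fromℕ (value β (t′ ∷ v))
      ≡ fromℕ (bit t) - fromℕ (bit t′) + (fromℕ (value β u) - fromℕ (value β v)) * fromℕ β
  difference-∷ β t t′ u v = trans (cong₂ _-_ (fromℕ-value β t u) (fromℕ-value β t′ v))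
    (solve 5 (λ e e′ p q β → e :+ p :* β :- (e′ :+ q :* β) := e :- e′ :+ (p :- q) :* β)
           refl (fromℕ (bit t)) (fromℕ (bit t′)) (fromℕ (value β u)) (fromℕ (value β v)) (fromℕ β))

  bit-difference : ∀ t t′ → let e = fromℕ (bit t) - fromℕ (bit t′) in ∣ e ∣ ≤ 1ℚ × e ² ≡ ∣ e ∣
  bit-difference false false = ℚ.nonNegative⁻¹ 1ℚ , refl
  bit-difference false true  = ℚ.≤-refl , refl
  bit-difference true  false = ℚ.≤-refl , refl
  bit-difference true  true  = ℚ.nonNegative⁻¹ 1ℚ , refl

  digitBound : ∀ {k} (u v : Vec Bool k) → DigitBound (a u - a v) (s u - s v)
  digitBound []      []       = ℚ.≤-refl
  digitBound (t ∷ u) (t′ ∷ v) =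
    let ∣e∣≤1 , e²≡∣e∣ = bit-difference t t′ in
    subst₂ DigitBound (sym (difference-∷ 8 t t′ u v)) (sym (difference-∷ 64 t t′ u v))
           (digitBound-step {a u - a v} {s u - s v} _ ∣e∣≤1 e²≡∣e∣ (digitBound u v))

  s-perturbation : ∀ {k} {u v : Vec Bool k} → u ≢ v → ∣ s u - s v ∣ < fromℕ 2 * (a u - a v) ²
  s-perturbation {u = u} {v} u≢v =
    digitBound⇒small (digitBound u v) (u≢v ∘ a-injective ∘ x∙y⁻¹≈ε⇒x≈y (a u) (a v))

  unperturbed : ∀ {k} → Cell k → ℚ × ℚ
  unperturbed c = fromℕ (abscissa c) , 0ℚ

  P Q C : ℕ → List Point
  P k = map (parabola (fromℕ 2)) (map < a , s > (bitVecs k))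
  Q k = map (parabola (fromℕ 2)) (map < a , -_ ∘ s > (bitVecs k))
  C k = map (parabola 1ℚ) (map unperturbed (cells k))

  perturbed-convIndep : ∀ k (σ : Vec Bool k → ℚ) →
    (∀ {u v} → u ≢ v → ∣ σ u - σ v ∣ < fromℕ 2 * (a u - a v) ²) →
    ConvIndep (map (parabola (fromℕ 2)) (map < a , σ > (bitVecs k)))
  perturbed-convIndep k σ small =
    parabola-convIndep (fromℕ 2) (Unique.map⁺ (a-injective ∘ cong proj₁) (bitVecs-unique k)) small′
    where
    small′ : ∀ {p q} → p ∈ map < a , σ > (bitVecs k) → q ∈ map < a , σ > (bitVecs k) → p ≢ q →
             ∣ proj₂ p - proj₂ q ∣ < fromℕ 2 * (proj₁ p - proj₁ q) ²
    small′ p∈ q∈ p≢q with ∈-map⁻ < a , σ > p∈ | ∈-map⁻ < a , σ > q∈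
    ... | _ , _ , refl | _ , _ , refl = small (p≢q ∘ cong < a , σ >)

  P-convIndep : ∀ k → ConvIndep (P k)
  P-convIndep k = perturbed-convIndep k s s-perturbation

  Q-convIndep : ∀ k → ConvIndep (Q k)
  Q-convIndep k = perturbed-convIndep k (-_ ∘ s) λ {u} {v} u≢v →
    subst (_< fromℕ 2 * (a u - a v) ²) (sym (∣-p-[-q]∣≡∣p-q∣ (s u) (s v))) (s-perturbation u≢v)
    where
    ∣-p-[-q]∣≡∣p-q∣ : ∀ p q → ∣ - p - - q ∣ ≡ ∣ p - q ∣
    ∣-p-[-q]∣≡∣p-q∣ p q = trans (cong ∣_∣ (solve 2 (λ p q → :- p :- :- q := :- (p :- q)) refl p q))
                             (ℚ.∣-p∣≡∣p∣ (p - q))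

  C-convIndep : ∀ k → ConvIndep (C k)
  C-convIndep k = parabola-convIndep 1ℚ
    (Unique.map⁺ (abscissa-injective ∘ fromℕ-injective ∘ cong proj₁) (cells-unique k)) distinct
    where
    distinct : ∀ {p q} → p ∈ map unperturbed (cells k) → q ∈ map unperturbed (cells k) → p ≢ q →
               ∣ proj₂ p - proj₂ q ∣ < 1ℚ * (proj₁ p - proj₁ q) ²
    distinct p∈ q∈ p≢q with ∈-map⁻ unperturbed p∈ | ∈-map⁻ unperturbed q∈
    ... | _ , _ , refl | _ , _ , refl = subst (0ℚ <_) (sym (ℚ.*-identityˡ _))
          (0<p² (p≢q ∘ cong (_, 0ℚ) ∘ x∙y⁻¹≈ε⇒x≈y _ _))

  sum-on-parabola : ∀ {k} (c : Cell k) →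
    parabola 1ℚ (unperturbed c)
      ≡ parabola (fromℕ 2) (a (bottom c) , s (bottom c)) +ᵖ parabola (fromℕ 2) (a (top c) , - s (top c))
  sum-on-parabola c = cong₂ _,_ abscissa≡x+y (begin-equality
      1ℚ * fromℕ (abscissa c) ² + 0ℚ
    ≡⟨ cong (λ z → 1ℚ * z ² + 0ℚ) abscissa≡x+y ⟩
      1ℚ * (x + y) ² + 0ℚ
    ≡⟨ solve 3 (λ x y σ → con 1ℚ :* ((x :+ y) :* (x :+ y)) :+ con 0ℚ
                := con (fromℕ 2) :* (x :* x) :+ σ
                   :+ (con (fromℕ 2) :* (y :* y) :+ :- (σ :+ (x :- y) :* (x :- y))))
               refl x y σ ⟩
      fromℕ 2 * x ² + σ + (fromℕ 2 * y ² + - (σ + (x - y) ²))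
    ≡⟨ cong (λ τ → fromℕ 2 * x ² + σ + (fromℕ 2 * y ² + - τ)) (s-top c) ⟨
      fromℕ 2 * x ² + σ + (fromℕ 2 * y ² + - s (top c))
    ∎)
    where
    x = a (bottom c)
    y = a (top c)
    σ = s (bottom c)
    abscissa≡x+y : fromℕ (abscissa c) ≡ x + y
    abscissa≡x+y = fromℕ-+ (value 8 (bottom c)) (value 8 (top c))

  C⊆P+Q : ∀ k → All (_∈Mink (P k , Q k)) (C k)
  C⊆P+Q k = All.map⁺ (All.map⁺ (All.universal sum∈P+Q (cells k)))
    where
    sum∈P+Q : (c : Cell k) → parabola 1ℚ (unperturbed c) ∈Mink (P k , Q k)
    sum∈P+Q c = _ , _ , ∈-map⁺ _ (∈-map⁺ _ (∈-bitVecs (bottom c)))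
                      , ∈-map⁺ _ (∈-map⁺ _ (∈-bitVecs (top c))) , sum-on-parabola c

open Construction

open import Data.Nat using (_≤_; _+_; _*_; _∸_; _^_)

theorem1p1 : Σ[ P ∈ (ℕ → List Point) ] Σ[ Q ∈ (ℕ → List Point) ]
    ((k : ℕ) → 1 ≤ k →
    ConvIndep (P k) × ConvIndep (Q k)
    × length (P k) ≡ 2 ^ k × length (Q k) ≡ 2 ^ k
    × ciMink≥ (P k) (Q k) ((k + 2) * 2 ^ (k ∸ 1)))
theorem1p1 = P , Q , λ where
  zero    ()
  (suc k) _ → P-convIndep (suc k) , Q-convIndep (suc k)
            , trans (length-map∘map _ _ (bitVecs (suc k))) (length-bitVecs (suc k))
            , trans (length-map∘map _ _ (bitVecs (suc k))) (length-bitVecs (suc k))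
            , C (suc k) , C-convIndep (suc k) , C⊆P+Q (suc k)
            , ℕ.≤-reflexive (sym (trans (length-map∘map _ _ (cells (suc k))) (length-cells k)))
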